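{- Let $\mathcal X$ be a scheme on $\Omega$ satisfying the $e_1/e_0$-condition, $\mathcal X'$ a scheme on $\Omega'$, and $\varphi:\mathcal X\to\mathcal X'$ an algebraic isomorphism. Assume that for all $\alpha\in\Omega$ and $\alpha'\in\Omega'$, $$\mathrm{Iso}_{\alpha_0,\alpha'_0}(\mathcal X_0,\mathcal X'_0,\varphi_0)^{\Delta_0}=\mathrm{Iso}_{\alpha,\alpha'}(\mathcal X_1,\mathcal X'_1,\varphi_1)^{\Delta_0}.\qquad(*)$$ Then for all $\alpha\in\Omega$ and $\alpha'\in\Omega'$: (i) $\mathrm{Iso}_{\alpha,\alpha'}(\mathcal X,\mathcal X',\varphi)^{\Omega_0}=\mathrm{Iso}_{\alpha_0,\alpha'_0}(\mathcal X_0,\mathcal X'_0,\varphi_0)$; (ii) $\mathrm{Iso}_{\alpha,\alpha'}(\mathcal X,\mathcal X',\varphi)^{\Delta}=\mathrm{Iso}_{\alpha,\alpha'}(\mathcal X_1,\mathcal X'_1,\varphi_1)$.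
   Context: A coherent configuration $\mathcal X=(\Omega,S)$ ($\Omega$ finite) is a partition $S$ of $\Omega^2$ with $1_\Omega$ a union of elements of $S$, closed under transposition, with intersection numbers $c_{rs}^t=|\alpha r\cap\beta s^*|$ independent of $(\alpha,\beta)\in t$; a scheme if $1_\Omega\in S$. Relations are unions of elements of $S$; parabolics are relations that are equivalence relations. An algebraic isomorphism $\varphi:\mathcal X\to\mathcal X'$ is a bijection $S\to S'$ preserving intersection numbers (extended by unions). $\mathrm{Iso}(\mathcal X,\mathcal X',\varphi)$ is the set of bijections $f$ with $s^f=\varphi(s)$ for all $s\in S$; $\mathrm{Iso}_{\beta,\beta'}(\cdot)$ is its subset with $\beta^f=\beta'$. For an equivalence relation $e$ and $s\subseteq\Omega^2$, $s_{\Omega/e}=\{(\Gamma,\Gamma'):s\cap(\Gamma\times\Gamma')\ne\emptyset\}$; $\mathrm{rad}(s)$ is the largest equivalence relation $e$ with $s=\bigcup_{(\Gamma,\Gamma')\in s_{\Omega/e}}\Gamma\times\Gamma'$. For parabolics $e_0\subseteq e_1$, $\mathcal X$ satisfies the $e_1/e_0$-condition if $s\cap e_1=\emptyset\Rightarrow e_0\subseteq\mathrm{rad}(s)$ for all $s\in S$. Notation: $e'_i=\varphi(e_i)$; $\Omega_0=\Omega/e_0$, $\Omega'_0=\Omega'/e'_0$; $\mathcal X_0$ (resp. $\mathcal X'_0$) is the quotient scheme on $\Omega_0$ with basis relations $s_{\Omega/e_0}$ (resp. on $\Omega'_0$); $\varphi_0:\mathcal X_0\to\mathcal X'_0$, $s_{\Omega/e_0}\mapsto\varphi(s)_{\Omega'/e'_0}$.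 For $\alpha\in\Omega$, $\alpha'\in\Omega'$: $\alpha_0=\alpha e_0$, $\alpha'_0=\alpha'e'_0$; $\Delta$ is the $e_1$-class containing $\alpha$, $\Delta'$ the $e'_1$-class containing $\alpha'$; $\Delta_0=\Delta/e_0\subseteq\Omega_0$, $\Delta'_0=\Delta'/e'_0$; $\mathcal X_1=\mathcal X_\Delta$, $\mathcal X'_1=\mathcal X'_{\Delta'}$ are the restrictions (basis relations the nonempty $s\cap\Delta^2$), and $\varphi_1:\mathcal X_1\to\mathcal X'_1$, $s\cap\Delta^2\mapsto\varphi(s)\cap\Delta'^2$. For a set $B$ of bijections, $B^{\Delta_0}$ is the set of the bijections $\Delta_0\to\Delta'_0$ obtained from the elements of $B$ mapping $\Delta_0$ onto $\Delta'_0$ (restrictions, for maps $\Omega_0\to\Omega'_0$) or mapping $\Delta$ onto $\Delta'$ and $e_0$-classes onto $e'_0$-classes (induced maps, for maps $\Delta\to\Delta'$); $B^{\Omega_0}$ is the set of the maps $\Omega_0\to\Omega'_0$ induced by the elements of $B$ mapping $e_0$ onto $e'_0$; $B^{\Delta}$ is the set of restrictions to $\Delta$ of elements of $B$ mapping $\Delta$ onto $\Delta'$. -}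

module Defs where

open import Data.Nat using (ℕ)
open import Data.Empty using (⊥)
open import Data.Fin using (Fin; _≟_)
open import Data.Fin.Subset using (Subset; _∈_; _⊆_)
open import Data.List using (length; filter; allFin)
open import Data.Product using (Σ; ∃; _×_; _,_; proj₁; proj₂)
open import Relation.Nullary using (_×-dec_)
open import Relation.Binary.PropositionalEquality using (_≡_)
open import Relation.Binary.Structures using (IsEquivalence)
open import Function.Bundles using (_↔_; Inverse; _⇔_)

-- A scheme on Ω = Fin n with r basis relations.  The partition S of Ω²
-- is given by a colouring  col : Ω → Ω → Fin r ; the basis relation
-- with colour s is { (α,β) : col α β ≡ s }.

inum : {n r : ℕ} → (Fin n → Fin n → Fin r) → Fin n → Fin n → Fin r → Fin r → ℕ
inum {n} col a b x y =
  length (filter (λ γ → (col a γ ≟ x) ×-dec (col γ b ≟ y)) (allFin n))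

record Scheme (n r : ℕ) : Set where
  field
    col      : Fin n → Fin n → Fin r
    nonempty : ∀ s → ∃ λ (p : Fin n × Fin n) → col (proj₁ p) (proj₂ p) ≡ s
    diag     : ∃ λ d → ∀ α β → (col α β ≡ d) ⇔ (α ≡ β)
    tr       : Fin r → Fin r
    tr-spec  : ∀ α β → col β α ≡ tr (col α β)
    coherent : ∀ a b a' b' x y → col a b ≡ col a' b' →
               inum col a b x y ≡ inum col a' b' x y

open Scheme public

record AlgIso {n r n' r' : ℕ} (X : Scheme n r) (X' : Scheme n' r') : Set where
  field
    φ        : Fin r ↔ Fin r'
    preserve : ∀ x y a b a' b' →
               col X' a' b' ≡ Inverse.to φ (col X a b) →
               inum (col X) a b x y ≡
               inum (col X') a' b' (Inverse.to φ x) (Inverse.to φ y)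

open AlgIso public

module _ {n r n' r' : ℕ} (X : Scheme n r) (X' : Scheme n' r') (A : AlgIso X X') where

  φ⁺ : Fin r → Fin r'
  φ⁺ = Inverse.to (φ A)

  φ⁻ : Fin r' → Fin r
  φ⁻ = Inverse.from (φ A)

  Rel : Subset r → Fin n → Fin n → Set
  Rel e α β = col X α β ∈ e

  Rel' : Subset r → Fin n' → Fin n' → Set
  Rel' e α' β' = φ⁻ (col X' α' β') ∈ e

  Parabolic : Subset r → Set
  Parabolic e = IsEquivalence (Rel e)

  -- e ⊆ rad(s), where rad(s) is the largest equivalence relation e with
  -- s = ⋃_{(Γ,Γ') ∈ s_{Ω/e}} Γ × Γ'.  Since rad(s) is the join of all
  -- equivalence relations with this property, e ⊆ rad(s) iff e itself
  -- has this property, which is written out here literally.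
  SubRad : Subset r → Fin r → Set
  SubRad e s = ∀ α β →
    (col X α β ≡ s) ⇔
    (∃ λ α₁ → ∃ λ β₁ → Rel e α α₁ × Rel e β β₁ × col X α₁ β₁ ≡ s)

  Condition : Subset r → Subset r → Set
  Condition e₁ e₀ = ∀ s → (s ∈ e₁ → ⊥) → SubRad e₀ s

  IsIso : Fin n → Fin n' → (Fin n → Fin n') → Set
  IsIso α α' f =
    (∀ β γ → f β ≡ f γ → β ≡ γ) ×
    (∀ β' → ∃ λ β → f β ≡ β') ×
    (∀ β γ → col X' (f β) (f γ) ≡ φ⁺ (col X β γ)) ×
    f α ≡ α'

  module _ (e₀ e₁ : Subset r) (α : Fin n) (α' : Fin n') where

    _~₀_ = Rel e₀
    _~₀'_ = Rel' e₀
    InΔ : Fin n → Set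
    InΔ β = Rel e₁ α β
    InΔ' : Fin n' → Set
    InΔ' β' = Rel' e₁ α' β'

    -- A map Ω₀ → Ω₀' is represented by a map
    -- g : Ω → Ω' on representatives sending e₀-classes into e₀'-classes
    -- (two such g represent the same map iff they agree up to e₀').
    IsIso₀ : (Fin n → Fin n') → Set
    IsIso₀ g =
      (∀ β γ → β ~₀ γ → g β ~₀' g γ) ×
      (∀ β γ → g β ~₀' g γ → β ~₀ γ) ×
      (∀ β' → ∃ λ β → g β ~₀' β') ×
      (∀ s β γ →
        (∃ λ β₁ → ∃ λ γ₁ → β ~₀ β₁ × γ ~₀ γ₁ × col X β₁ γ₁ ≡ s) ⇔
        (∃ λ β₁' → ∃ λ γ₁' → g β ~₀' β₁' × g γ ~₀' γ₁' ×
                             col X' β₁' γ₁' ≡ φ⁺ s)) ×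
      g α ~₀' α'

    -- Iso_{α,α'}(X₁, X₁', φ₁): bijections Δ → Δ' (represented by maps
    -- Ω → Ω' whose values only matter on Δ) with α ↦ α' and
    -- (s ∩ Δ²)^h = φ(s) ∩ Δ'².
    IsIso₁ : (Fin n → Fin n') → Set
    IsIso₁ h =
      (∀ β → InΔ β → InΔ' (h β)) ×
      (∀ β γ → InΔ β → InΔ γ → h β ≡ h γ → β ≡ γ) ×
      (∀ β' → InΔ' β' → ∃ λ β → InΔ β × h β ≡ β') ×
      (∀ β γ → InΔ β → InΔ γ → col X' (h β) (h γ) ≡ φ⁺ (col X β γ)) ×
      h α ≡ α'

    MapsΔ₀ : (Fin n → Fin n') → Set
    MapsΔ₀ g = (∀ β → InΔ β → InΔ' (g β)) ×
               (∀ β' → InΔ' β' → ∃ λ β → InΔ β × g β ~₀' β')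

    MapsClassesΔ : (Fin n → Fin n') → Set
    MapsClassesΔ h = ∀ β γ → InΔ β → InΔ γ → (β ~₀ γ) ⇔ (h β ~₀' h γ)

    MapsE₀ : (Fin n → Fin n') → Set
    MapsE₀ f = ∀ β γ → (β ~₀ γ) ⇔ (f β ~₀' f γ)

    MapsΔ : (Fin n → Fin n') → Set
    MapsΔ f = (∀ β → InΔ β → InΔ' (f β)) ×
              (∀ β' → InΔ' β' → ∃ λ β → InΔ β × f β ≡ β')

    Star : Set
    Star =
      (∀ g → IsIso₀ g → MapsΔ₀ g →
        ∃ λ h → IsIso₁ h × MapsClassesΔ h ×
                (∀ β → InΔ β → h β ~₀' g β)) ×
      (∀ h → IsIso₁ h → MapsClassesΔ h →
        ∃ λ g → IsIso₀ g × MapsΔ₀ g ×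
                (∀ β → InΔ β → g β ~₀' h β))

    Concl-i : Set
    Concl-i =
      (∀ f → IsIso α α' f → MapsE₀ f → IsIso₀ f) ×
      (∀ g → IsIso₀ g →
        ∃ λ f → IsIso α α' f × MapsE₀ f × (∀ β → f β ~₀' g β))

    Concl-ii : Set
    Concl-ii =
      (∀ f → IsIso α α' f → MapsΔ f → IsIso₁ f) ×
      (∀ h → IsIso₁ h →
        ∃ λ f → IsIso α α' f × MapsΔ f × (∀ β → InΔ β → f β ≡ h β))

module Submission where

-- The inclusions ⊆ in (i) and (ii) hold by restriction. For ⊇, a map g in Iso(X₀, X₀', φ₀) is
-- lifted class by class: on the e₁-class of each δ, (*) at (δ, g δ) gives an isomorphism onto
-- the e₁'-class of g δ inducing g, while on the class of α a prescribed isomorphism h, matched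
-- with g by (*) at (α, α'), is used. Choosing one such piece per class through a canonical
-- representative glues them into a bijection f of Ω that induces g and extends h. A colour s between two classes avoids e₁, so
-- e₀ ⊆ rad(s); since an algebraic isomorphism lifts every triangle of Ω' to a triangle of Ω with
-- the same colours, this radical condition carries over to φ(s), so the colour of
-- (f β, f γ) is determined by the e₀'-classes of f β and f γ, which are those of g β and g γ.

open import Defs
open import Data.Nat using (ℕ; _<_)
open import Data.Fin using (Fin)
open import Data.Fin.Subset using (Subset; _⊆_; _∈_)
open import Data.Fin.Subset.Properties using (_∈?_)
open import Data.Product using (_×_; _,_; proj₁; proj₂; ∃; ∃₂)
open import Data.List using (List; []; _∷_; length; filter; allFin; head)
open import Data.List.Properties using (filter-some; filter-≐)
open import Data.List.Relation.Unary.All using (_∷_)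
open import Data.List.Relation.Unary.All.Properties using (all-filter)
open import Data.List.Relation.Unary.Any using (here; there)
open import Data.List.Membership.Propositional using (lose) renaming (_∈_ to _∈ᴸ_)
open import Data.List.Membership.Propositional.Properties using (∈-allFin; ∈-filter⁺)
open import Data.Maybe using (fromMaybe)
open import Relation.Nullary using (Dec; yes; no; contradiction)
open import Relation.Binary.PropositionalEquality
open import Relation.Binary.Structures using (IsEquivalence)
open import Function.Bundles using (Inverse; _⇔_; mk⇔; Equivalence)

module _ {A : Set} {P : A → Set} (P? : ∀ x → Dec (P x)) where

  filter-positive⇒∃ : ∀ xs → 0 < length (filter P? xs) → ∃ P
  filter-positive⇒∃ xs pos with filter P? xs | all-filter P? xs
  ... | y ∷ _ | py ∷ _ = y , py

fromMaybe-head-irrelevant : ∀ {A : Set} {x : A} {xs} d d' → x ∈ᴸ xs →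
                            fromMaybe d (head xs) ≡ fromMaybe d' (head xs)
fromMaybe-head-irrelevant d d' (here _)  = refl
fromMaybe-head-irrelevant d d' (there _) = refl

module Representatives {n : ℕ} {_∼_ : Fin n → Fin n → Set}
                       (∼-equiv : IsEquivalence _∼_) (_∼?_ : ∀ β γ → Dec (β ∼ γ)) where

  open IsEquivalence ∼-equiv renaming (refl to ∼-refl; sym to ∼-sym; trans to ∼-trans)

  class : Fin n → List (Fin n)
  class β = filter (_∼? β) (allFin n)

  rep : Fin n → Fin n
  rep β = fromMaybe β (head (class β))

  rep-∼ : ∀ β → rep β ∼ β
  rep-∼ β with class β | all-filter (_∼? β) (allFin n)
  ... | [] | _ = ∼-refl
  ... | _ ∷ _ | p ∷ _ = p

  rep-cong : ∀ {β γ} → β ∼ γ → rep β ≡ rep γ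
  rep-cong {β} {γ} β∼γ = begin
    fromMaybe β (head (class β)) ≡⟨ cong (λ L → fromMaybe β (head L)) same-class ⟩
    fromMaybe β (head (class γ)) ≡⟨ fromMaybe-head-irrelevant β γ γ∈class ⟩
    fromMaybe γ (head (class γ)) ∎
    where
    open ≡-Reasoning
    same-class : class β ≡ class γ
    same-class = filter-≐ (_∼? β) (_∼? γ)
                   ((λ p → ∼-trans p β∼γ) , (λ p → ∼-trans p (∼-sym β∼γ))) (allFin n)
    γ∈class : γ ∈ᴸ class γ
    γ∈class = ∈-filter⁺ (_∼? γ) (∈-allFin γ) ∼-refl

module _ {n r : ℕ} (X : Scheme n r) where

  Path : Fin n → Fin n → Fin r → Fin r → Set
  Path a b x y = ∃ λ γ → col X a γ ≡ x × col X γ b ≡ y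

  inum-positive⇒path : ∀ {a b x y} → 0 < inum (col X) a b x y → Path a b x y
  inum-positive⇒path = filter-positive⇒∃ _ (allFin n)

  path⇒inum-positive : ∀ {a b x y} → Path a b x y → 0 < inum (col X) a b x y
  path⇒inum-positive (γ , p) = filter-some _ (lose (∈-allFin γ) p)

  diagonal-colour-unique : ∀ {a b γ} → col X a b ≡ col X γ γ → a ≡ b
  diagonal-colour-unique {γ = γ} eq =
    Equivalence.to (isDiagonal _ _) (trans eq (Equivalence.from (isDiagonal γ γ) refl))
    where isDiagonal = proj₂ (diag X)

  diagonal-colour-constant : ∀ a b → col X a a ≡ col X b b
  diagonal-colour-constant a b =
    trans (Equivalence.from (isDiagonal a a) refl) (sym (Equivalence.from (isDiagonal b b) refl))
    where isDiagonal = proj₂ (diag X)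

module AlgebraicIsomorphism {n r n' r' : ℕ} (X : Scheme n r) (X' : Scheme n' r')
                            (A : AlgIso X X') where

  Φ : Fin r → Fin r'
  Φ = φ⁺ X X' A

  Φ⁻¹ : Fin r' → Fin r
  Φ⁻¹ = φ⁻ X X' A

  Φ⁻¹-≡ : ∀ {x x'} → x' ≡ Φ x → Φ⁻¹ x' ≡ x
  Φ⁻¹-≡ {x} refl = Inverse.strictlyInverseʳ (φ A) x

  Φ-≡ : ∀ {x x'} → Φ⁻¹ x' ≡ x → x' ≡ Φ x
  Φ-≡ {x' = x'} refl = sym (Inverse.strictlyInverseˡ (φ A) x')

  Φ-injective : ∀ {x y} → Φ x ≡ Φ y → x ≡ y
  Φ-injective eq = trans (sym (Φ⁻¹-≡ refl)) (Φ⁻¹-≡ eq)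

  pullback-path : ∀ {a b a' b' x' y'} → col X' a' b' ≡ Φ (col X a b) →
                  Path X' a' b' x' y' → Path X a b (Φ⁻¹ x') (Φ⁻¹ y')
  pullback-path {a} {b} {a'} {b'} {x'} {y'} a'b' (γ' , a'γ' , γ'b') =
    inum-positive⇒path X
      (subst (0 <_) (sym (preserve A (Φ⁻¹ x') (Φ⁻¹ y') a b a' b' a'b'))
        (path⇒inum-positive X' (γ' , trans a'γ' (Φ-≡ refl) , trans γ'b' (Φ-≡ refl))))

  lift-triangle : ∀ a' b' c' → ∃₂ λ a b → ∃ λ γ →
                  Φ⁻¹ (col X' a' c') ≡ col X a b ×
                  Φ⁻¹ (col X' a' b') ≡ col X a γ ×
                  Φ⁻¹ (col X' b' c') ≡ col X γ b
  lift-triangle a' b' c' with nonempty X (Φ⁻¹ (col X' a' c'))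
  ... | (a , b) , ab with pullback-path (Φ-≡ (sym ab)) (b' , refl , refl)
  ... | γ , aγ , γb = a , b , γ , sym ab , sym aγ , sym γb

  Φ⁻¹-diagonal : ∀ a a' → Φ⁻¹ (col X' a' a') ≡ col X a a
  Φ⁻¹-diagonal a a' with nonempty X' (Φ (col X a a))
  ... | (p' , q') , p'q' with pullback-path p'q' (p' , refl , refl)
  ... | γ , aγ , γa = begin
    Φ⁻¹ (col X' a' a') ≡⟨ cong Φ⁻¹ (diagonal-colour-constant X' a' p') ⟩
    Φ⁻¹ (col X' p' p') ≡⟨ aγ ⟨
    col X a γ          ≡⟨ cong (col X a) (diagonal-colour-unique X (trans γa (Φ⁻¹-≡ p'q'))) ⟩
    col X a a          ∎
    where open ≡-Reasoning

  Φ-respects-Rel : ∀ (e : Subset r) {a b a' b'} → col X' a' b' ≡ Φ (col X a b) →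
                   Rel X X' A e a b ⇔ Rel' X X' A e a' b'
  Φ-respects-Rel e ab = mk⇔ (subst (_∈ e) (sym (Φ⁻¹-≡ ab))) (subst (_∈ e) (Φ⁻¹-≡ ab))

  module _ {e : Subset r} (parabolic : Parabolic X X' A e) where

    open IsEquivalence parabolic renaming (refl to ∼-refl; sym to ∼-sym; trans to ∼-trans)

    Rel'-isEquivalence : IsEquivalence (Rel' X X' A e)
    Rel'-isEquivalence = record { refl = ≈-refl ; sym = ≈-sym ; trans = ≈-trans }
      where
      ≈-refl : ∀ {a'} → Rel' X X' A e a' a'
      ≈-refl {a'} with lift-triangle a' a' a'
      ... | a , _ = subst (_∈ e) (sym (Φ⁻¹-diagonal a a')) ∼-refl

      ≈-sym : ∀ {a' b'} → Rel' X X' A e a' b' → Rel' X X' A e b' a'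
      ≈-sym {a'} {b'} a'b' with lift-triangle a' b' a'
      ... | a , b , γ , ab , aγ , γb
            with refl ← diagonal-colour-unique X (trans (sym ab) (Φ⁻¹-diagonal a a')) =
        subst (_∈ e) (sym γb) (∼-sym (subst (_∈ e) aγ a'b'))

      ≈-trans : ∀ {a' b' c'} → Rel' X X' A e a' b' → Rel' X X' A e b' c' → Rel' X X' A e a' c'
      ≈-trans {a'} {b'} {c'} a'b' b'c' with lift-triangle a' b' c'
      ... | a , b , γ , ab , aγ , γb =
        subst (_∈ e) (sym ab) (∼-trans (subst (_∈ e) aγ a'b') (subst (_∈ e) γb b'c'))

    open IsEquivalence Rel'-isEquivalence using () renaming (sym to ≈-sym)

    subRad⇒Φ-colour-respects-Rel' : ∀ {s} → SubRad X X' A e s →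
      ∀ {a' b' a'' b''} → col X' a' b' ≡ Φ s →
      Rel' X X' A e a' a'' → Rel' X X' A e b' b'' → col X' a'' b'' ≡ Φ s
    subRad⇒Φ-colour-respects-Rel' {s} rad a'b' a'a'' b'b'' = right (left a'b' a'a'') b'b''
      where
      left : ∀ {a' b' a''} → col X' a' b' ≡ Φ s → Rel' X X' A e a' a'' → col X' a'' b' ≡ Φ s
      left {a'} {b'} {a''} a'b' a'a'' with lift-triangle a'' a' b'
      ... | a , b , γ , ab , aγ , γb =
        Φ-≡ (trans ab (Equivalence.from (rad a b)
          (γ , b , subst (_∈ e) aγ (≈-sym a'a'') , ∼-refl , trans (sym γb) (Φ⁻¹-≡ a'b'))))

      right : ∀ {a' b' b''} → col X' a' b' ≡ Φ s → Rel' X X' A e b' b'' → col X' a' b'' ≡ Φ s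
      right {a'} {b'} {b''} a'b' b'b'' with lift-triangle a' b' b''
      ... | a , b , γ , ab , aγ , γb =
        Φ-≡ (trans ab (Equivalence.from (rad a b)
          (a , γ , ∼-refl , ∼-sym (subst (_∈ e) γb b'b'') , trans (sym aγ) (Φ⁻¹-≡ a'b'))))

module Gluing {n r n' r' : ℕ} (X : Scheme n r) (X' : Scheme n' r') (A : AlgIso X X')
              (e₀ e₁ : Subset r) (P₀ : Parabolic X X' A e₀) (P₁ : Parabolic X X' A e₁)
              (e₀⊆e₁ : e₀ ⊆ e₁) (condition : Condition X X' A e₁ e₀) where

  open AlgebraicIsomorphism X X' A

  _∼₀_ _∼₁_ : Fin n → Fin n → Set
  _∼₀_ = Rel X X' A e₀
  _∼₁_ = Rel X X' A e₁

  _≈₀_ _≈₁_ : Fin n' → Fin n' → Set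
  _≈₀_ = Rel' X X' A e₀
  _≈₁_ = Rel' X X' A e₁

  open IsEquivalence P₀ using () renaming (refl to ∼₀-refl)
  open IsEquivalence P₁ using () renaming (refl to ∼₁-refl; sym to ∼₁-sym; trans to ∼₁-trans)
  open IsEquivalence (Rel'-isEquivalence P₀) public using ()
    renaming (refl to ≈₀-refl; sym to ≈₀-sym; trans to ≈₀-trans)
  open IsEquivalence (Rel'-isEquivalence P₁) using ()
    renaming (refl to ≈₁-refl; sym to ≈₁-sym; trans to ≈₁-trans)

  _∼₁?_ : ∀ β γ → Dec (β ∼₁ γ)
  β ∼₁? γ = col X β γ ∈? e₁

  open Representatives P₁ _∼₁?_

  -- Colour preservation alone makes f map e₀ onto e₀', so (i) needs no such hypothesis.
  isIso⇒isIso₀ : ∀ {α α' f} → IsIso X X' A α α' f → IsIso₀ X X' A e₀ e₁ α α' f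
  isIso⇒isIso₀ {α} {α'} {f} (f-injective , f-surjective , f-colour , f-α) =
    (λ β γ → Equivalence.to (f-maps-e₀ β γ)) ,
    (λ β γ → Equivalence.from (f-maps-e₀ β γ)) ,
    (λ β' → let β , fβ≡β' = f-surjective β' in β , subst (f β ≈₀_) fβ≡β' ≈₀-refl) ,
    (λ s β γ → mk⇔
      (λ (β₁ , γ₁ , β∼β₁ , γ∼γ₁ , β₁γ₁) →
        f β₁ , f γ₁ , Equivalence.to (f-maps-e₀ β β₁) β∼β₁ , Equivalence.to (f-maps-e₀ γ γ₁) γ∼γ₁ ,
        trans (f-colour β₁ γ₁) (cong Φ β₁γ₁))
      (λ (β₁' , γ₁' , fβ≈β₁' , fγ≈γ₁' , β₁'γ₁') →
        let β₁ , fβ₁≡β₁' = f-surjective β₁'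
            γ₁ , fγ₁≡γ₁' = f-surjective γ₁'
        in β₁ , γ₁ ,
           Equivalence.from (f-maps-e₀ β β₁) (subst (f β ≈₀_) (sym fβ₁≡β₁') fβ≈β₁') ,
           Equivalence.from (f-maps-e₀ γ γ₁) (subst (f γ ≈₀_) (sym fγ₁≡γ₁') fγ≈γ₁') ,
           Φ-injective (trans (sym (f-colour β₁ γ₁))
                              (trans (cong₂ (col X') fβ₁≡β₁' fγ₁≡γ₁') β₁'γ₁')))) ,
    subst (_≈₀ α') (sym f-α) ≈₀-refl
    where
    f-maps-e₀ : MapsE₀ X X' A e₀ e₁ α α' f
    f-maps-e₀ β γ = Φ-respects-Rel e₀ (f-colour β γ)

  isIso⇒isIso₁ : ∀ {α α' f} → IsIso X X' A α α' f → MapsΔ X X' A e₀ e₁ α α' f →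
                 IsIso₁ X X' A e₀ e₁ α α' f
  isIso⇒isIso₁ (f-injective , _ , f-colour , f-α) (f-into , f-onto) =
    f-into , (λ β γ _ _ → f-injective β γ) , f-onto , (λ β γ _ _ → f-colour β γ) , f-α

  isIso₁⇒mapsClassesΔ : ∀ {α α' h} → IsIso₁ X X' A e₀ e₁ α α' h → MapsClassesΔ X X' A e₀ e₁ α α' h
  isIso₁⇒mapsClassesΔ (_ , _ , _ , h-colour , _) β γ α∼β α∼γ =
    Φ-respects-Rel e₀ (h-colour β γ α∼β α∼γ)

  agrees-on-Δ⇒mapsΔ : ∀ {α α' f h} → IsIso₁ X X' A e₀ e₁ α α' h →
                      (∀ β → α ∼₁ β → f β ≡ h β) → MapsΔ X X' A e₀ e₁ α α' f
  agrees-on-Δ⇒mapsΔ {α' = α'} (h-into , _ , h-onto , _) f≡h =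
    (λ β α∼β → subst (α' ≈₁_) (sym (f≡h β α∼β)) (h-into β α∼β)) ,
    (λ β' α'≈β' → let β , α∼β , hβ≡β' = h-onto β' α'≈β' in β , α∼β , trans (f≡h β α∼β) hβ≡β')

  module QuotientIso {α α'} {g : Fin n → Fin n'} (g-iso : IsIso₀ X X' A e₀ e₁ α α' g) where

    g-surjective : ∀ β' → ∃ λ β → g β ≈₀ β'
    g-surjective = proj₁ (proj₂ (proj₂ g-iso))

    g-α : g α ≈₀ α'
    g-α = proj₂ (proj₂ (proj₂ (proj₂ g-iso)))

    g-colour : ∀ β γ → ∃₂ λ β' γ' → g β ≈₀ β' × g γ ≈₀ γ' × col X' β' γ' ≡ Φ (col X β γ)
    g-colour β γ = Equivalence.to (proj₁ (proj₂ (proj₂ (proj₂ g-iso))) (col X β γ) β γ)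
                     (β , γ , ∼₀-refl , ∼₀-refl , refl)

    g-colour⁻ : ∀ β γ → ∃₂ λ β₁ γ₁ → β ∼₀ β₁ × γ ∼₀ γ₁ × col X β₁ γ₁ ≡ Φ⁻¹ (col X' (g β) (g γ))
    g-colour⁻ β γ = Equivalence.from (proj₁ (proj₂ (proj₂ (proj₂ g-iso))) _ β γ)
                      (g β , g γ , ≈₀-refl , ≈₀-refl , Φ-≡ refl)

    g-preserves-∼₁ : ∀ {β γ} → β ∼₁ γ → g β ≈₁ g γ
    g-preserves-∼₁ {β} {γ} β∼γ =
      let β' , γ' , gβ≈β' , gγ≈γ' , β'γ' = g-colour β γ in
      ≈₁-trans (e₀⊆e₁ gβ≈β')
        (≈₁-trans (Equivalence.to (Φ-respects-Rel e₁ β'γ') β∼γ) (≈₁-sym (e₀⊆e₁ gγ≈γ')))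

    g-reflects-∼₁ : ∀ {β γ} → g β ≈₁ g γ → β ∼₁ γ
    g-reflects-∼₁ {β} {γ} gβ≈gγ =
      let β₁ , γ₁ , β∼β₁ , γ∼γ₁ , β₁γ₁ = g-colour⁻ β γ in
      ∼₁-trans (e₀⊆e₁ β∼β₁) (∼₁-trans (subst (_∈ e₁) (sym β₁γ₁) gβ≈gγ) (∼₁-sym (e₀⊆e₁ γ∼γ₁)))

    rebase : ∀ {δ δ'} → g δ ≈₀ δ' → IsIso₀ X X' A e₀ e₁ δ δ' g
    rebase gδ≈δ' = let wd , inj , surj , colour , _ = g-iso in wd , inj , surj , colour , gδ≈δ'

    g-maps-Δ₀ : ∀ {δ δ'} → g δ ≈₀ δ' → MapsΔ₀ X X' A e₀ e₁ δ δ' g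
    g-maps-Δ₀ gδ≈δ' =
      (λ β δ∼β → ≈₁-trans (≈₁-sym (e₀⊆e₁ gδ≈δ')) (g-preserves-∼₁ δ∼β)) ,
      (λ β' δ'≈β' → let β , gβ≈β' = g-surjective β' in
        β , g-reflects-∼₁ (≈₁-trans (e₀⊆e₁ gδ≈δ') (≈₁-trans δ'≈β' (≈₁-sym (e₀⊆e₁ gβ≈β')))) , gβ≈β')

    record Patch (δ : Fin n) : Set where
      field
        map        : Fin n → Fin n'
        near       : ∀ β → δ ∼₁ β → map β ≈₀ g β
        injective  : ∀ β γ → δ ∼₁ β → δ ∼₁ γ → map β ≡ map γ → β ≡ γ
        surjective : ∀ β' → g δ ≈₁ β' → ∃ λ β → δ ∼₁ β × map β ≡ β'
        colour     : ∀ β γ → δ ∼₁ β → δ ∼₁ γ → col X' (map β) (map γ) ≡ Φ (col X β γ)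

    isIso₁⇒patch : ∀ {b b' δ h} → IsIso₁ X X' A e₀ e₁ b b' h → (∀ β → b ∼₁ β → h β ≈₀ g β) →
                   b ∼₁ δ → b' ≈₁ g δ → Patch δ
    isIso₁⇒patch {h = h} (_ , h-injective , h-onto , h-colour , _) h≈g b∼δ b'≈gδ = record
      { map        = h
      ; near       = λ β δ∼β → h≈g β (∼₁-trans b∼δ δ∼β)
      ; injective  = λ β γ δ∼β δ∼γ → h-injective β γ (∼₁-trans b∼δ δ∼β) (∼₁-trans b∼δ δ∼γ)
      ; surjective = λ β' gδ≈β' →
          let β , b∼β , hβ≡β' = h-onto β' (≈₁-trans b'≈gδ gδ≈β')
          in β , ∼₁-trans (∼₁-sym b∼δ) b∼β , hβ≡β'
      ; colour     = λ β γ δ∼β δ∼γ → h-colour β γ (∼₁-trans b∼δ δ∼β) (∼₁-trans b∼δ δ∼γ)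
      }

    module Glue (patch : ∀ δ → Patch δ) where

      module PatchOf (β : Fin n) = Patch (patch (rep β))

      f : Fin n → Fin n'
      f β = PatchOf.map β β

      f-near : ∀ β → f β ≈₀ g β
      f-near β = PatchOf.near β β (rep-∼ β)

      f-local : ∀ {β γ} → β ∼₁ γ → f γ ≡ PatchOf.map β γ
      f-local {γ = γ} β∼γ = cong (λ δ → Patch.map (patch δ) γ) (rep-cong (∼₁-sym β∼γ))

      rep∼ : ∀ {β γ} → β ∼₁ γ → rep β ∼₁ γ
      rep∼ β∼γ = ∼₁-trans (rep-∼ _) β∼γ

      f-reflects-∼₁ : ∀ {β γ} → f β ≈₁ f γ → β ∼₁ γ
      f-reflects-∼₁ {β} {γ} fβ≈fγ =
        g-reflects-∼₁ (≈₁-trans (e₀⊆e₁ (≈₀-sym (f-near β))) (≈₁-trans fβ≈fγ (e₀⊆e₁ (f-near γ))))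

      f-injective : ∀ β γ → f β ≡ f γ → β ≡ γ
      f-injective β γ fβ≡fγ =
        PatchOf.injective β β γ (rep∼ ∼₁-refl) (rep∼ β∼γ) (trans fβ≡fγ (f-local β∼γ))
        where β∼γ = f-reflects-∼₁ (subst (f β ≈₁_) fβ≡fγ ≈₁-refl)

      f-surjective : ∀ β' → ∃ λ γ → f γ ≡ β'
      f-surjective β' =
        let β , gβ≈β' = g-surjective β'
            γ , rep∼γ , mapγ≡β' =
              PatchOf.surjective β β' (≈₁-trans (g-preserves-∼₁ (rep-∼ β)) (e₀⊆e₁ gβ≈β'))
        in γ , trans (f-local (∼₁-trans (∼₁-sym (rep-∼ β)) rep∼γ)) mapγ≡β'

      -- Across e₁-classes the colour is seen by g alone, because e₀ ⊆ rad(s) there.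
      f-colour : ∀ β γ → col X' (f β) (f γ) ≡ Φ (col X β γ)
      f-colour β γ with β ∼₁? γ
      ... | yes β∼γ = trans (cong (col X' (f β)) (f-local β∼γ))
                            (PatchOf.colour β β γ (rep∼ ∼₁-refl) (rep∼ β∼γ))
      ... | no β≁γ =
        let β' , γ' , gβ≈β' , gγ≈γ' , β'γ' = g-colour β γ in
        subRad⇒Φ-colour-respects-Rel' P₀ (condition (col X β γ) β≁γ) β'γ'
          (≈₀-sym (≈₀-trans (f-near β) gβ≈β')) (≈₀-sym (≈₀-trans (f-near γ) gγ≈γ'))

  module _ (star : ∀ δ δ' → Star X X' A e₀ e₁ δ δ') where

    extend : ∀ {α α' g h} → IsIso₀ X X' A e₀ e₁ α α' g → IsIso₁ X X' A e₀ e₁ α α' h →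
             (∀ β → α ∼₁ β → h β ≈₀ g β) →
             ∃ λ f → IsIso X X' A α α' f × MapsE₀ X X' A e₀ e₁ α α' f ×
                     (∀ β → f β ≈₀ g β) × (∀ β → α ∼₁ β → f β ≡ h β)
    extend {α} {α'} {g} {h} g-iso h-iso h≈g =
      f , (f-injective , f-surjective , f-colour , f-α) ,
      (λ β γ → Φ-respects-Rel e₀ (f-colour β γ)) , f-near , f-on-Δ
      where
      open QuotientIso g-iso

      patch : ∀ δ → Patch δ
      patch δ with α ∼₁? δ
      ... | yes α∼δ =
        isIso₁⇒patch h-iso h≈g α∼δ (≈₁-trans (≈₁-sym (e₀⊆e₁ g-α)) (g-preserves-∼₁ α∼δ))
      ... | no _ =
        let h' , h'-iso , _ , h'≈g = proj₁ (star δ (g δ)) g (rebase ≈₀-refl) (g-maps-Δ₀ ≈₀-refl)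
        in isIso₁⇒patch h'-iso h'≈g ∼₁-refl ≈₁-refl

      open Glue patch

      f-on-Δ : ∀ β → α ∼₁ β → f β ≡ h β
      f-on-Δ β α∼β with α ∼₁? rep β
      ... | yes _ = refl
      ... | no α≁rep = contradiction (∼₁-trans α∼β (∼₁-sym (rep-∼ β))) α≁rep

      f-α : f α ≡ α'
      f-α = trans (f-on-Δ α ∼₁-refl) (proj₂ (proj₂ (proj₂ (proj₂ h-iso))))

lemma5p3 : {n r n' r' : ℕ} (X : Scheme n r) (X' : Scheme n' r')
           (A : AlgIso X X') (e₀ e₁ : Subset r) →
           Parabolic X X' A e₀ → Parabolic X X' A e₁ → e₀ ⊆ e₁ →
           Condition X X' A e₁ e₀ →
           (∀ α α' → Star X X' A e₀ e₁ α α') →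
           ∀ α α' → Concl-i X X' A e₀ e₁ α α' × Concl-ii X X' A e₀ e₁ α α'
lemma5p3 X X' A e₀ e₁ P₀ P₁ e₀⊆e₁ condition star α α' =
  ( (λ _ f-iso _ → isIso⇒isIso₀ f-iso)
  , λ g g-iso →
      let open QuotientIso g-iso
          h , h-iso , _ , h≈g = proj₁ (star α α') g g-iso (g-maps-Δ₀ g-α)
          f , f-iso , f-maps-e₀ , f≈g , _ = extend star g-iso h-iso h≈g
      in f , f-iso , f-maps-e₀ , f≈g )
  , ( (λ _ → isIso⇒isIso₁)
    , λ h h-iso →
        let g , g-iso , _ , g≈h = proj₂ (star α α') h h-iso (isIso₁⇒mapsClassesΔ h-iso)
            f , f-iso , _ , _ , f≡h = extend star g-iso h-iso (λ β α∼β → ≈₀-sym (g≈h β α∼β))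
        in f , f-iso , agrees-on-Δ⇒mapsΔ h-iso f≡h , f≡h )
  where open Gluing X X' A e₀ e₁ P₀ P₁ e₀⊆e₁ condition
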